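{- Let $\Gamma$ be an infinite abelian group, $F\colon\Gamma\to\Gamma$ an injective endomorphism, and $\Sigma$ an $F$-spanning set. Define $\lambda_\Sigma\colon\Gamma\to\mathbb{R}_{\ge0}$ by $\lambda_\Sigma(a)=2^\ell$, where $\ell$ is the length of a shortest $\sigma\in\Sigma^*$ with $[\sigma]_F=a$. Then $\lambda_\Sigma$ is a length function for $(\Gamma,F)$ with associated constants $C=D=E=2$ and exceptional set $\Sigma$.
   Context: For a string $\sigma=s_0\cdots s_n$ of elements of $\Gamma$, $[\sigma]_F=s_0+Fs_1+\cdots+F^ns_n$ (empty string gives $0$). $\Sigma^*$ denotes finite strings over $\Sigma$. A finite $\Sigma\subseteq\Gamma$ is an $F$-spanning set if: (i) every $a\in\Gamma$ equals $[\sigma]_F$ for some $\sigma\in\Sigma^*$; (ii) $0\in\Sigma$ and $\Sigma=-\Sigma$; (iii) for $a_1,\dots,a_5\in\Sigma$, $a_1+\cdots+a_5\in\Sigma+F\Sigma$; (iv) if $a_1,a_2,a_3\in\Sigma$ and $a_1+a_2+a_3\in F\Gamma$ then $a_1+a_2+a_3\in F\Sigma$. A length function for $(\Gamma,F)$ with associated constants $C,D,E$ and exceptional set $A$ is $\lambda\colon\Gamma\to\mathbb{R}_{\ge0}$ with: $\lambda(a)=\lambda(-a)$ for all $a$; $D\ge1$ and $\lambda(a+b)\le D\max(\lambda(a),\lambda(b))$ for all $a,b$; for every $N\in\mathbb{N}$ only finitely many $a$ have $\lambda(a)\le N$; $A$ finite, $C>1$, $E\ge1$, $\lambda(Fa)\le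 C\lambda(a)$ for all $a\in\Gamma$, and $\lambda(F^na)\ge\frac{C^n}{E}\lambda(a)$ for all $a\in\Gamma\setminus A$ and $n\in\mathbb{N}$. -}

module Defs where

open import Level using (Level; _⊔_)
open import Algebra.Bundles using (AbelianGroup)
open import Algebra.Morphism.Structures using (module GroupMorphisms)
open import Data.Nat as ℕ using (ℕ; zero; suc; _^_; _≤_; _<_) renaming (_*_ to _*ℕ_; _⊔_ to _⊔ℕ_)
open import Data.List using (List; []; _∷_; length)
open import Data.List.Relation.Unary.All using (All)
open import Data.Product using (Σ; ∃; _×_; _,_)
open import Relation.Nullary using (¬_)
open import Relation.Binary.PropositionalEquality using (_≡_)
import Data.List.Membership.Setoid as SetoidMembership

module _ {c ℓ : Level} (G : AbelianGroup c ℓ) where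
  open AbelianGroup G renaming (Carrier to Γ)
  open SetoidMembership setoid using (_∈_)
  open GroupMorphisms rawGroup rawGroup using (IsGroupMonomorphism)

  IsInjectiveEndo : (Γ → Γ) → Set (c ⊔ ℓ)
  IsInjectiveEndo F = IsGroupMonomorphism F

  IsInfinite : Set (c ⊔ ℓ)
  IsInfinite = ¬ (Σ (List Γ) λ L → ∀ a → a ∈ L)

  -- [σ]_F = s₀ + F s₁ + ... + Fⁿ sₙ, computed Horner-style; [] ↦ 0
  ⟦_⟧[_] : List Γ → (Γ → Γ) → Γ
  ⟦ [] ⟧[ F ] = ε
  ⟦ s ∷ σ ⟧[ F ] = s ∙ F (⟦ σ ⟧[ F ])

  IsString : List Γ → List Γ → Set (c ⊔ ℓ)
  IsString Sg σ = All (_∈ Sg) σ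

  record IsFSpanning (F : Γ → Γ) (Sg : List Γ) : Set (c ⊔ ℓ) where
    field
      spans   : ∀ a → Σ (List Γ) λ σ → IsString Sg σ × ⟦ σ ⟧[ F ] ≈ a
      zero∈   : ε ∈ Sg
      neg-closed : ∀ a → (a ∈ Sg → a ⁻¹ ∈ Sg) × (a ⁻¹ ∈ Sg → a ∈ Sg)
      sum5    : ∀ a₁ a₂ a₃ a₄ a₅ → a₁ ∈ Sg → a₂ ∈ Sg → a₃ ∈ Sg → a₄ ∈ Sg → a₅ ∈ Sg →
                Σ Γ λ b → Σ Γ λ d → b ∈ Sg × d ∈ Sg ×
                  ((((a₁ ∙ a₂) ∙ a₃) ∙ a₄) ∙ a₅ ≈ b ∙ F d)
      sum3    : ∀ a₁ a₂ a₃ → a₁ ∈ Sg → a₂ ∈ Sg → a₃ ∈ Sg →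
                (Σ Γ λ g → (a₁ ∙ a₂) ∙ a₃ ≈ F g) →
                Σ Γ λ d → d ∈ Sg × ((a₁ ∙ a₂) ∙ a₃ ≈ F d)

  IsShortestLength : (F : Γ → Γ) (Sg : List Γ) → Γ → ℕ → Set (c ⊔ ℓ)
  IsShortestLength F Sg a n =
    (Σ (List Γ) λ σ → IsString Sg σ × ⟦ σ ⟧[ F ] ≈ a × length σ ≡ n)
    × (∀ σ → IsString Sg σ → ⟦ σ ⟧[ F ] ≈ a → n ≤ length σ)

  iter : (Γ → Γ) → ℕ → Γ → Γ
  iter F zero a = a
  iter F (suc n) a = F (iter F n a)

  -- Length function for (Γ, F) with constants C, D, E and exceptional set A,
  -- specialised to ℕ-valued λ and ℕ constants; the condition
  -- λ(Fⁿ a) ≥ (Cⁿ / E) λ(a) is written multiplicatively as Cⁿ λ(a) ≤ E λ(Fⁿ a).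
  record IsLengthFunction (F : Γ → Γ) (len : Γ → ℕ) (C D E : ℕ) (A : List Γ) : Set (c ⊔ ℓ) where
    field
      cong-len  : ∀ {a b} → a ≈ b → len a ≡ len b
      symm      : ∀ a → len a ≡ len (a ⁻¹)
      D≥1       : 1 ≤ D
      quasi-ultra : ∀ a b → len (a ∙ b) ≤ D *ℕ (len a ⊔ℕ len b)
      finite-balls : ∀ (N : ℕ) → Σ (List Γ) λ L → ∀ a → len a ≤ N → a ∈ L
      C>1       : 1 < C
      E≥1       : 1 ≤ E
      F-upper   : ∀ a → len (F a) ≤ C *ℕ len a
      F-lower   : ∀ a → ¬ (a ∈ A) → ∀ (n : ℕ) → (C ^ n) *ℕ len a ≤ E *ℕ len (iter F n a)

{-# OPTIONS --safe #-}
-- Schoolbook addition of two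
-- expansions with at most n digits, the carries staying in Σ by condition (iii), gives an
-- expansion of the sum with at most n + 1 digits: this is the bound with D = 2, and prepending
-- the digit 0 gives λ(F a) ≤ 2 λ(a). Conversely, by condition (iv) and injectivity of F the
-- lowest digit can be stripped off an expansion of F y, leaving an expansion of y up to one
-- extra digit of Σ; stripping n digits from a shortest expansion of Fⁿ a shows
-- ℓ(a) ≤ ℓ(Fⁿ a) − n + 1 when a ∉ Σ, which is the lower bound with C = E = 2.
module Submission where

open import Defs
open import Level using (Level) renaming (_⊔_ to _⊔ℓ_)
open import Algebra.Bundles using (AbelianGroup)
open import Data.Nat using (ℕ; _^_; zero; suc; _+_; _*_; _∸_; _⊔_; _≤_; _<_; z≤n; s≤s)
open import Data.List using (List; []; _∷_; length; map; drop; cartesianProductWith)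

open import Algebra.Morphism.Structures using (module GroupMorphisms)
import Algebra.Properties.AbelianGroup as AbelianGroupProperties
import Algebra.Properties.CommutativeSemigroup as CommutativeSemigroupProperties
open import Data.Nat.Properties
  using (≤-refl; ≤-reflexive; ≤-trans; ≤-antisym; <⇒≤; +-monoʳ-≤; +-mono-≤; +-suc; +-identityʳ;
         m≤m⊔n; m≤n⊔m; m+[n∸m]≡n; m∸n≢0⇒n<m; n>0⇒n≢0; ^-monoʳ-≤; ^-distribˡ-+-*; m^n>0;
         mono-≤-distrib-⊔)
open import Data.List.Properties using (length-map; length-drop; drop-drop)
open import Data.List.Relation.Unary.All using ([]; _∷_)
import Data.List.Relation.Unary.All as All
import Data.List.Relation.Unary.All.Properties as All
open import Data.List.Relation.Unary.Any using (here; there)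
import Data.List.Membership.Setoid as SetoidMembership
import Data.List.Membership.Setoid.Properties as SetoidMembershipProperties
open import Data.Product using (Σ; _×_; _,_; proj₁; proj₂)
open import Relation.Nullary using (¬_; contradiction)
open import Relation.Binary.PropositionalEquality as ≡ using (_≡_)
import Relation.Binary.Reasoning.Setoid as SetoidReasoning

n<2^n : ∀ n → n < 2 ^ n
n<2^n zero = s≤s z≤n
n<2^n (suc n) = ≤-trans (+-mono-≤ (m^n>0 2 n) (n<2^n n))
                        (≤-reflexive (≡.cong (2 ^ n +_) (≡.sym (+-identityʳ (2 ^ n)))))

module Expansions {c ℓ : Level} (G : AbelianGroup c ℓ) where

  open AbelianGroup G renaming (Carrier to Γ)
  open AbelianGroupProperties G using (x≈z//y; ⁻¹-∙-comm; ε⁻¹≈ε; ⁻¹-involutive)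
  open CommutativeSemigroupProperties commutativeSemigroup using (interchange; x∙yz≈xz∙y; xy∙z≈xz∙y)
  open SetoidMembership setoid using (_∈_)
  open SetoidMembershipProperties using (∈-resp-≈; ∈-cartesianProductWith⁺)
  open GroupMorphisms rawGroup rawGroup using (IsGroupHomomorphism; IsGroupMonomorphism)
  open SetoidReasoning setoid

  module Evaluation {F : Γ → Γ} (F-hom : IsGroupHomomorphism F) (Sg : List Γ) where

    open IsGroupHomomorphism F-hom public using (homo; ε-homo; ⁻¹-homo; ⟦⟧-cong)

    ⟦_⟧ : List Γ → Γ
    ⟦ σ ⟧ = ⟦_⟧[_] G σ F

    _∈Σ* : List Γ → Set (c ⊔ℓ ℓ)
    σ ∈Σ* = IsString G Sg σ

    lead : List Γ → Γ
    lead [] = ε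
    lead (s ∷ _) = s

    ⟦⟧-lead : ∀ σ → ⟦ σ ⟧ ≈ lead σ ∙ F ⟦ drop 1 σ ⟧
    ⟦⟧-lead [] = sym (trans (∙-congˡ ε-homo) (identityʳ ε))
    ⟦⟧-lead (s ∷ σ) = refl

    ⟦⟧-map-⁻¹ : ∀ σ → ⟦ map _⁻¹ σ ⟧ ≈ ⟦ σ ⟧ ⁻¹
    ⟦⟧-map-⁻¹ [] = sym ε⁻¹≈ε
    ⟦⟧-map-⁻¹ (s ∷ σ) = begin
      s ⁻¹ ∙ F ⟦ map _⁻¹ σ ⟧ ≈⟨ ∙-congˡ (⟦⟧-cong (⟦⟧-map-⁻¹ σ)) ⟩
      s ⁻¹ ∙ F (⟦ σ ⟧ ⁻¹)    ≈⟨ ∙-congˡ (⁻¹-homo ⟦ σ ⟧) ⟩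
      s ⁻¹ ∙ F ⟦ σ ⟧ ⁻¹      ≈⟨ ⁻¹-∙-comm s (F ⟦ σ ⟧) ⟩
      (s ∙ F ⟦ σ ⟧) ⁻¹       ∎

    expansions : ℕ → List Γ
    expansions zero = ε ∷ []
    expansions (suc N) = ε ∷ cartesianProductWith (λ s v → s ∙ F v) Sg (expansions N)

    ∈-expansions : ∀ {σ} N → σ ∈Σ* → length σ ≤ N → ⟦ σ ⟧ ∈ expansions N
    ∈-expansions {[]} zero _ _ = here refl
    ∈-expansions {[]} (suc N) _ _ = here refl
    ∈-expansions {s ∷ σ} (suc N) (s∈ ∷ σ∈) (s≤s l) =
      there (∈-cartesianProductWith⁺ setoid setoid setoid (λ p q → ∙-cong p (⟦⟧-cong q))
                                      s∈ (∈-expansions N σ∈ l))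

  module Spanning {F : Γ → Γ} (F-mono : IsInjectiveEndo G F) {Sg : List Γ}
                  (spanning : IsFSpanning G F Sg) where

    open IsGroupMonomorphism F-mono using (isGroupHomomorphism; injective)
    open Evaluation isGroupHomomorphism Sg public
    open IsFSpanning spanning

    lead-∈ : ∀ {σ} → σ ∈Σ* → lead σ ∈ Sg
    lead-∈ [] = zero∈
    lead-∈ (s∈ ∷ _) = s∈

    map-⁻¹-∈Σ* : ∀ {σ} → σ ∈Σ* → map _⁻¹ σ ∈Σ*
    map-⁻¹-∈Σ* σ∈ = All.map⁺ (All.map (λ {a} → proj₁ (neg-closed a)) σ∈)

    carry : ∀ {a₁ a₂ a₃} → a₁ ∈ Sg → a₂ ∈ Sg → a₃ ∈ Sg →
            Σ Γ λ b → Σ Γ λ d → b ∈ Sg × d ∈ Sg × (a₁ ∙ a₂) ∙ a₃ ≈ b ∙ F d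
    carry {a₁} {a₂} {a₃} a₁∈ a₂∈ a₃∈ =
      let b , d , b∈ , d∈ , e = sum5 a₁ a₂ a₃ ε ε a₁∈ a₂∈ a₃∈ zero∈ zero∈
      in  b , d , b∈ , d∈ , trans (sym (trans (identityʳ _) (identityʳ _))) e

    add : ∀ n {σ τ c} → σ ∈Σ* → τ ∈Σ* → c ∈ Sg → length σ ≤ n → length τ ≤ n →
          Σ (List Γ) λ ρ → ρ ∈Σ* × ⟦ ρ ⟧ ≈ (⟦ σ ⟧ ∙ ⟦ τ ⟧) ∙ c × length ρ ≤ suc n
    add zero {[]} {[]} {c} _ _ c∈ _ _ =
      c ∷ [] , c∈ ∷ [] , trans (trans (∙-congˡ ε-homo) (identityʳ c))
                               (sym (trans (∙-congʳ (identityʳ ε)) (identityˡ c))) , ≤-refl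
    add (suc n) {σ} {τ} {c} σ∈ τ∈ c∈ lσ lτ =
      let b , d , b∈ , d∈ , carried = carry (lead-∈ σ∈) (lead-∈ τ∈) c∈
          ρ , ρ∈ , ⟦ρ⟧≈ , lρ = add n (All.drop⁺ 1 σ∈) (All.drop⁺ 1 τ∈) d∈ (tail≤ σ lσ) (tail≤ τ lτ)
      in  b ∷ ρ , b∈ ∷ ρ∈ , sum ρ carried ⟦ρ⟧≈ , s≤s lρ
      where
      tail≤ : ∀ (υ : List Γ) → length υ ≤ suc n → length (drop 1 υ) ≤ n
      tail≤ [] _ = z≤n
      tail≤ (_ ∷ _) (s≤s l) = l

      sum : ∀ {b d} ρ → (lead σ ∙ lead τ) ∙ c ≈ b ∙ F d →
            ⟦ ρ ⟧ ≈ (⟦ drop 1 σ ⟧ ∙ ⟦ drop 1 τ ⟧) ∙ d → b ∙ F ⟦ ρ ⟧ ≈ (⟦ σ ⟧ ∙ ⟦ τ ⟧) ∙ c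
      sum {b} {d} ρ carried ⟦ρ⟧≈ = begin
        b ∙ F ⟦ ρ ⟧                        ≈⟨ ∙-congˡ (trans (⟦⟧-cong ⟦ρ⟧≈) (trans (homo _ _) (∙-congʳ (homo _ _)))) ⟩
        b ∙ ((F x ∙ F y) ∙ F d)            ≈⟨ x∙yz≈xz∙y b (F x ∙ F y) (F d) ⟩
        (b ∙ F d) ∙ (F x ∙ F y)            ≈⟨ ∙-congʳ carried ⟨
        ((lead σ ∙ lead τ) ∙ c) ∙ (F x ∙ F y) ≈⟨ xy∙z≈xz∙y (lead σ ∙ lead τ) c (F x ∙ F y) ⟩
        ((lead σ ∙ lead τ) ∙ (F x ∙ F y)) ∙ c ≈⟨ ∙-congʳ (interchange (lead σ) (lead τ) (F x) (F y)) ⟩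
        ((lead σ ∙ F x) ∙ (lead τ ∙ F y)) ∙ c ≈⟨ ∙-congʳ (∙-cong (⟦⟧-lead σ) (⟦⟧-lead τ)) ⟨
        (⟦ σ ⟧ ∙ ⟦ τ ⟧) ∙ c                ∎
        where x = ⟦ drop 1 σ ⟧; y = ⟦ drop 1 τ ⟧

    add-digit : ∀ {d τ} → d ∈ Sg → τ ∈Σ* →
                Σ (List Γ) λ ρ → ρ ∈Σ* × ⟦ ρ ⟧ ≈ d ∙ ⟦ τ ⟧ × length ρ ≤ suc (length τ)
    add-digit {d} {τ} d∈ τ∈ =
      let ρ , ρ∈ , ⟦ρ⟧≈ , lρ = add (length τ) τ∈ [] d∈ ≤-refl z≤n
      in  ρ , ρ∈ , trans ⟦ρ⟧≈ (trans (∙-congʳ (identityʳ ⟦ τ ⟧)) (comm ⟦ τ ⟧ d)) , lρ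

    -- If F y = d + [s₀ s₁ …], then d + s₀ is divisible by F, so by (iv) it is F d′ with d′ ∈ Σ.
    peel : ∀ {y d σ} → d ∈ Sg → σ ∈Σ* → F y ≈ d ∙ ⟦ σ ⟧ →
           Σ Γ λ d′ → d′ ∈ Sg × y ≈ d′ ∙ ⟦ drop 1 σ ⟧
    peel {y} {d} {σ} d∈ σ∈ Fy≈ =
      let d′ , d′∈ , d∙r≈Fd′ = sum3 d (lead σ) ε d∈ (lead-∈ σ∈) zero∈ (y ∙ t ⁻¹ , divisible)
      in  d′ , d′∈ , injective (begin
            F y                  ≈⟨ split ⟩
            (d ∙ lead σ) ∙ F t   ≈⟨ ∙-congʳ (trans (sym (identityʳ _)) d∙r≈Fd′) ⟩
            F d′ ∙ F t           ≈⟨ homo d′ t ⟨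
            F (d′ ∙ t)           ∎)
      where
      t = ⟦ drop 1 σ ⟧

      split : F y ≈ (d ∙ lead σ) ∙ F t
      split = trans Fy≈ (trans (∙-congˡ (⟦⟧-lead σ)) (sym (assoc d (lead σ) (F t))))

      divisible : (d ∙ lead σ) ∙ ε ≈ F (y ∙ t ⁻¹)
      divisible = begin
        (d ∙ lead σ) ∙ ε     ≈⟨ identityʳ _ ⟩
        d ∙ lead σ           ≈⟨ x≈z//y _ _ _ (sym split) ⟩
        F y ∙ (F t) ⁻¹       ≈⟨ ∙-congˡ (⁻¹-homo t) ⟨
        F y ∙ F (t ⁻¹)       ≈⟨ homo y (t ⁻¹) ⟨
        F (y ∙ t ⁻¹)         ∎

    peel-iter : ∀ n {x d σ} → d ∈ Sg → σ ∈Σ* → iter G F n x ≈ d ∙ ⟦ σ ⟧ →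
                Σ Γ λ d′ → d′ ∈ Sg × x ≈ d′ ∙ ⟦ drop n σ ⟧
    peel-iter zero d∈ _ e = _ , d∈ , e
    peel-iter (suc n) {x} {σ = σ} d∈ σ∈ e =
      let d₁ , d₁∈ , e₁ = peel d∈ σ∈ e
          d₂ , d₂∈ , e₂ = peel-iter n d₁∈ (All.drop⁺ 1 σ∈) e₁
      in  d₂ , d₂∈ , ≡.subst (λ υ → x ≈ d₂ ∙ ⟦ υ ⟧) (drop-drop 1 n σ) e₂

  module ShortestLength {F : Γ → Γ} (F-mono : IsInjectiveEndo G F) {Sg : List Γ}
                        (spanning : IsFSpanning G F Sg) (ℓΣ : Γ → ℕ)
                        (shortest : ∀ a → IsShortestLength G F Sg a (ℓΣ a)) where

    open Spanning F-mono spanning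
    open IsFSpanning spanning using (zero∈)

    ℓ-≤ : ∀ {a σ n} → σ ∈Σ* → ⟦ σ ⟧ ≈ a → length σ ≤ n → ℓΣ a ≤ n
    ℓ-≤ {a} σ∈ e l = ≤-trans (proj₂ (shortest a) _ σ∈ e) l

    ℓ-≤-resp-≈ : ∀ {a b} → a ≈ b → ℓΣ a ≤ ℓΣ b
    ℓ-≤-resp-≈ {b = b} a≈b =
      let σ , σ∈ , ⟦σ⟧≈b , lσ = proj₁ (shortest b)
      in  ℓ-≤ σ∈ (trans ⟦σ⟧≈b (sym a≈b)) (≤-reflexive lσ)

    ℓ-resp-≈ : ∀ {a b} → a ≈ b → ℓΣ a ≡ ℓΣ b
    ℓ-resp-≈ a≈b = ≤-antisym (ℓ-≤-resp-≈ a≈b) (ℓ-≤-resp-≈ (sym a≈b))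

    ℓ-⁻¹-≤ : ∀ a → ℓΣ (a ⁻¹) ≤ ℓΣ a
    ℓ-⁻¹-≤ a =
      let σ , σ∈ , ⟦σ⟧≈a , lσ = proj₁ (shortest a)
      in  ℓ-≤ (map-⁻¹-∈Σ* σ∈) (trans (⟦⟧-map-⁻¹ σ) (⁻¹-cong ⟦σ⟧≈a))
              (≤-reflexive (≡.trans (length-map _⁻¹ σ) lσ))

    ℓ-⁻¹ : ∀ a → ℓΣ (a ⁻¹) ≡ ℓΣ a
    ℓ-⁻¹ a = ≤-antisym (ℓ-⁻¹-≤ a)
      (≤-trans (≤-reflexive (ℓ-resp-≈ (sym (⁻¹-involutive a)))) (ℓ-⁻¹-≤ (a ⁻¹)))

    ℓ-∙ : ∀ a b → ℓΣ (a ∙ b) ≤ suc (ℓΣ a ⊔ ℓΣ b)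
    ℓ-∙ a b =
      let σ , σ∈ , ⟦σ⟧≈a , lσ = proj₁ (shortest a)
          τ , τ∈ , ⟦τ⟧≈b , lτ = proj₁ (shortest b)
          ρ , ρ∈ , ⟦ρ⟧≈ , lρ = add (ℓΣ a ⊔ ℓΣ b) σ∈ τ∈ zero∈
                                  (≤-trans (≤-reflexive lσ) (m≤m⊔n _ _))
                                  (≤-trans (≤-reflexive lτ) (m≤n⊔m _ _))
      in  ℓ-≤ ρ∈ (trans ⟦ρ⟧≈ (trans (identityʳ _) (∙-cong ⟦σ⟧≈a ⟦τ⟧≈b))) lρ

    ℓ-F : ∀ a → ℓΣ (F a) ≤ suc (ℓΣ a)
    ℓ-F a =
      let σ , σ∈ , ⟦σ⟧≈a , lσ = proj₁ (shortest a)
      in  ℓ-≤ (zero∈ ∷ σ∈) (trans (identityˡ _) (⟦⟧-cong ⟦σ⟧≈a)) (s≤s (≤-reflexive lσ))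

    ∉⇒tail-nonempty : ∀ {a d τ} → ¬ a ∈ Sg → d ∈ Sg → a ≈ d ∙ ⟦ τ ⟧ → 0 < length τ
    ∉⇒tail-nonempty {τ = []} a∉ d∈ a≈ = contradiction (∈-resp-≈ setoid (sym (trans a≈ (identityʳ _))) d∈) a∉
    ∉⇒tail-nonempty {τ = _ ∷ _} _ _ _ = s≤s z≤n

    ℓ-iter : ∀ {a} → ¬ a ∈ Sg → ∀ n → n + ℓΣ a ≤ suc (ℓΣ (iter G F n a))
    ℓ-iter {a} a∉ n =
      let σ , σ∈ , ⟦σ⟧≈ , lσ = proj₁ (shortest (iter G F n a))
          d , d∈ , a≈ = peel-iter n zero∈ σ∈ (sym (trans (identityˡ _) ⟦σ⟧≈))
          τ∈ = All.drop⁺ n σ∈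
          ρ , ρ∈ , ⟦ρ⟧≈ , lρ = add-digit d∈ τ∈
          lτ = ≡.trans (length-drop n σ) (≡.cong (_∸ n) lσ)
          n≤L = <⇒≤ (m∸n≢0⇒n<m (n>0⇒n≢0 (≡.subst (0 <_) lτ (∉⇒tail-nonempty {τ = drop n σ} a∉ d∈ a≈))))
          ℓa≤ = ℓ-≤ ρ∈ (trans ⟦ρ⟧≈ (sym a≈)) (≤-trans lρ (s≤s (≤-reflexive lτ)))
      in  ≤-trans (+-monoʳ-≤ n ℓa≤) (≤-reflexive (≡.trans (+-suc n _) (≡.cong suc (m+[n∸m]≡n {n} n≤L))))

    ℓ-bounded-∈ : ∀ {a N} → ℓΣ a ≤ N → a ∈ expansions N
    ℓ-bounded-∈ {a} {N} ℓa≤N =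
      let σ , σ∈ , ⟦σ⟧≈a , lσ = proj₁ (shortest a)
      in  ∈-resp-≈ setoid ⟦σ⟧≈a (∈-expansions N σ∈ (≤-trans (≤-reflexive lσ) ℓa≤N))

proposition3p8 : ∀ {c ℓ : Level} (G : AbelianGroup c ℓ) →
    IsInfinite G →
    (F : AbelianGroup.Carrier G → AbelianGroup.Carrier G) → IsInjectiveEndo G F →
    (Sg : List (AbelianGroup.Carrier G)) → IsFSpanning G F Sg →
    (ℓΣ : AbelianGroup.Carrier G → ℕ) →
    (∀ a → IsShortestLength G F Sg a (ℓΣ a)) →
    IsLengthFunction G F (λ a → 2 ^ ℓΣ a) 2 2 2 Sg
proposition3p8 G _ F F-mono Sg spanning ℓΣ shortest = record
  { cong-len     = λ a≈b → ≡.cong (2 ^_) (ℓ-resp-≈ a≈b)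
  ; symm         = λ a → ≡.cong (2 ^_) (≡.sym (ℓ-⁻¹ a))
  ; D≥1          = s≤s z≤n
  ; quasi-ultra  = λ a b → ≤-trans (^-monoʳ-≤ 2 (ℓ-∙ a b))
                     (≤-reflexive (≡.cong (2 *_) (mono-≤-distrib-⊔ (^-monoʳ-≤ 2) (ℓΣ a) (ℓΣ b))))
  ; finite-balls = λ N → expansions N , λ a 2^ℓa≤N → ℓ-bounded-∈ (≤-trans (<⇒≤ (n<2^n (ℓΣ a))) 2^ℓa≤N)
  ; C>1          = s≤s (s≤s z≤n)
  ; E≥1          = s≤s z≤n
  ; F-upper      = λ a → ^-monoʳ-≤ 2 (ℓ-F a)
  ; F-lower      = λ a a∉ n → ≡.subst (_≤ 2 * 2 ^ ℓΣ (iter G F n a)) (^-distribˡ-+-* 2 n (ℓΣ a))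
                                      (^-monoʳ-≤ 2 (ℓ-iter a∉ n))
  }
  where open Expansions G using (module Spanning; module ShortestLength)
        open Spanning F-mono spanning using (expansions)
        open ShortestLength F-mono spanning ℓΣ shortest
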